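{- Let $X$ be a finite nonempty linearly ordered set and let $C$ be a simplicial complex with $\bigcup C\subseteq TX$ such that $\kappa_X$ faithfully realizes $C$. If $B$ and $B\cup\{\beta\}$ are building sets of $C$, then for $\alpha=[\max B_\beta]^+$ we have \[\mathrm{Sb}_X(C,B\cup\{\beta\})=\mathrm{Bl}_\alpha\,\mathrm{Sb}_X(C,B).\]
   Context: A simplicial complex is a set $C=P(\alpha_1)\cup\ldots\cup P(\alpha_m)$, $m\ge1$, with $P(\cdot)$ the power set and the $\alpha_i$ finite pairwise $\subseteq$-incomparable sets (bases). For a family $B$ and set $\beta$, $B_\beta=B\cap P(\beta)$, and $\max Z$ denotes the set of $\subseteq$-maximal members of a family $Z$. A building set of $P(\gamma)$ ($\gamma$ finite) is a set $B$ of nonempty subsets of $\gamma$ with (B1) $\beta,\delta\in B$, $\beta\cap\delta\ne\emptyset$ imply $\beta\cup\delta\in B$, (B2) $\{a\}\in B$ for $a\in\gamma$. A building set of $C$ with bases $\alpha_i$ is $B\subseteq C$ with every $B_{\alpha_i}$ a building set of $P(\alpha_i)$. An $N$-antichain is a set of at least two pairwise $\subseteq$-incomparable members of $N$. $N\subseteq B$ is nested if for every $N$-antichain $\{\beta_1,\ldots,\beta_t\}$, $\beta_1\cup\ldots\cup\beta_t\in C-B$; $\widetilde{\mathcal N}(C,B)$ is the simplicial complex of nested subsets of $B$. $TX$ is the free commutative semigroup generated by $X$ (formal sums $\sum_j k_jx_j$, positive integer coefficients). If $X=\{x_1<\ldots<x_d\}$, $\kappa_X:TX\to\mathbb R^d$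 sends $\sum_jk_jx_j$ to $(k_1,\ldots,k_d)$. A function $f$ into $\mathbb R^d$ faithfully realizes a simplicial complex $E$ if for all $\alpha,\beta\in E$ and positive reals $k_a,l_b$, $\sum_{a\in\alpha}k_af(a)=\sum_{b\in\beta}l_bf(b)$ implies $\alpha=\beta$ and $k_a=l_a$. For finite nonempty $\gamma\subseteq TX$, $\gamma^+\in TX$ is the sum in $TX$ of the elements of $\gamma$, and $[B]^+=\{\gamma^+\mid\gamma\in B\}$. $\mathrm{Sb}_X(C,B)=\{[N]^+\mid N\in\widetilde{\mathcal N}(C,B)\}$. For a simplicial complex $E$ with $\bigcup E\subseteq TX$ and a finite nonempty $\alpha\subseteq TX$, the blowup is $\mathrm{Bl}_\alpha E=\{\gamma\in E\mid\alpha\not\subseteq\gamma\}\cup\{\gamma\cup\{\alpha^+\}\mid\alpha\not\subseteq\gamma\text{ and }\alpha\cup\gamma\in E\}$. -}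

module Defs where

open import Data.Nat as ℕ using (ℕ)
open import Data.Integer using (+_)
open import Data.Rational as ℚ using (ℚ; 0ℚ)
open import Data.Vec as Vec using (Vec; replicate; zipWith)
open import Data.Vec.Properties using (≡-dec)
open import Data.List using (List; []; _∷_; _++_; concat; map; foldr; deduplicate; filter; length)
open import Data.List.Membership.Propositional using (_∈_)
open import Data.List.Relation.Unary.All using (All)
open import Data.List.Relation.Unary.Any using (Any; any?)
open import Data.List.Relation.Unary.AllPairs using (AllPairs)
open import Data.Product using (Σ; ∃; ∃-syntax; _×_; _,_)
open import Data.Sum using (_⊎_)
open import Relation.Nullary using (¬_; ¬?)
open import Relation.Nullary.Decidable using (_×-dec_)
open import Relation.Binary.PropositionalEquality using (_≡_; _≢_)
open import Function.Bundles using (_⇔_)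

-- The linearly ordered set X = {x_0 < ... < x_{d-1}} is Fin d.
-- An element Σ_j k_j x_j of TX is represented by its coefficient
-- vector (k_0,...,k_{d-1}) ∈ ℕ^d (which must be nonzero); so TX is
-- the set of nonzero vectors in ℕ^d and the semigroup sum is pointwise +.

V : ℕ → Set
V d = Vec ℕ d

_≟V_ : ∀ {d} (u v : V d) → Relation.Nullary.Dec (u ≡ v)
_≟V_ = ≡-dec ℕ._≟_

InTX : ∀ {d} → V d → Set
InTX {d} v = v ≢ replicate d 0

-- finite sets of vertices, as lists (read up to set equality)
FSet : ℕ → Set
FSet d = List (V d)

Fam : ℕ → Set
Fam d = List (FSet d)

open import Data.List.Relation.Binary.Subset.Propositional using (_⊆_)
import Data.List.Relation.Binary.Subset.DecPropositional as DecSub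

_≐_ : ∀ {d} → FSet d → FSet d → Set
s ≐ t = (s ⊆ t) × (t ⊆ s)

_∈ᶠ_ : ∀ {d} → FSet d → Fam d → Set
γ ∈ᶠ F = Any (λ δ → δ ≐ γ) F

_⊆ᵈ_ : ∀ {d} → FSet d → FSet d → Set
_⊆ᵈ_ {d} s t = _⊆_ {A = V d} s t

⊆ᵈ? : ∀ {d} (s t : FSet d) → Relation.Nullary.Dec (s ⊆ᵈ t)
⊆ᵈ? {d} = DecSub._⊆?_ (_≟V_ {d})

Incomp : ∀ {d} → FSet d → FSet d → Set
Incomp s t = ¬ (s ⊆ᵈ t) × ¬ (t ⊆ᵈ s)

_⁺ : ∀ {d} → FSet d → V d
_⁺ {d} γ = foldr (zipWith ℕ._+_) (replicate d 0) (deduplicate _≟V_ γ)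

[_]⁺ : ∀ {d} → Fam d → FSet d
[ B ]⁺ = map _⁺ B

-- B_β = B ∩ P(β)
restrict : ∀ {d} → Fam d → FSet d → Fam d
restrict B β = filter (λ δ → ⊆ᵈ? δ β) B

maxF : ∀ {d} → Fam d → Fam d
maxF Z = filter (λ δ → ¬? (any? (λ ε → ⊆ᵈ? δ ε ×-dec ¬? (⊆ᵈ? ε δ)) Z)) Z

-- Simplicial complexes, given by a list of bases α_1,...,α_m (m ≥ 1,
-- pairwise ⊆-incomparable); C = P(α_1) ∪ ... ∪ P(α_m).

record Complex (d : ℕ) : Set where
  field
    bases    : Fam d
    nonempty : 1 ℕ.≤ length bases
    incomp   : AllPairs Incomp bases

open Complex public

_∈C_ : ∀ {d} → FSet d → Complex d → Set
γ ∈C C = Any (λ α → γ ⊆ᵈ α) (bases C)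

VerticesInTX : ∀ {d} → Complex d → Set
VerticesInTX C = All (λ α → ∀ v → v ∈ α → InTX v) (bases C)

-- κ_X : TX → ℚ^d (coefficient vector), and faithful realization.
-- Positive real coefficients are replaced by positive rational ones
--.

κ : ∀ {d} → V d → Vec ℚ d
κ = Vec.map (λ n → + n ℚ./ 1)

linComb : ∀ {d} → (V d → ℚ) → FSet d → Vec ℚ d
linComb {d} k γ =
  foldr (λ a acc → zipWith ℚ._+_ (Vec.map (k a ℚ.*_) (κ a)) acc)
        (replicate d 0ℚ) (deduplicate _≟V_ γ)

FaithfullyRealizes : ∀ {d} → Complex d → Set
FaithfullyRealizes {d} C =
  ∀ (α β : FSet d) → α ∈C C → β ∈C C →
  ∀ (k l : V d → ℚ) →
  (∀ a → a ∈ α → 0ℚ ℚ.< k a) → (∀ b → b ∈ β → 0ℚ ℚ.< l b) →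
  linComb k α ≡ linComb l β →
  (α ≐ β) × (∀ a → a ∈ α → k a ≡ l a)

IsBuildingSetOfP : ∀ {d} → Fam d → FSet d → Set
IsBuildingSetOfP {d} B α =
  (∀ δ → δ ∈ᶠ B → δ ⊆ᵈ α → ∃[ x ] x ∈ δ)
  × (∀ δ ε → δ ∈ᶠ B → δ ⊆ᵈ α → ε ∈ᶠ B → ε ⊆ᵈ α →
       (∃[ x ] (x ∈ δ × x ∈ ε)) → (δ ++ ε) ∈ᶠ B)
  × (∀ a → a ∈ α → (a ∷ []) ∈ᶠ B)

IsBuildingSet : ∀ {d} → Complex d → Fam d → Set
IsBuildingSet C B =
  (∀ δ → δ ∈ᶠ B → δ ∈C C) × All (IsBuildingSetOfP B) (bases C)

IsAntichain : ∀ {d} → Fam d → Fam d → Set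
IsAntichain N A = All (_∈ᶠ N) A × (2 ℕ.≤ length A) × AllPairs Incomp A

IsNested : ∀ {d} → Complex d → Fam d → Fam d → Set
IsNested C B N =
  All (_∈ᶠ B) N ×
  (∀ A → IsAntichain N A → (concat A ∈C C) × ¬ (concat A ∈ᶠ B))

Sb : ∀ {d} → Complex d → Fam d → FSet d → Set
Sb {d} C B γ = ∃[ N ] (IsNested C B N × (γ ≐ [ N ]⁺))

Bl : ∀ {d} → FSet d → (FSet d → Set) → FSet d → Set
Bl {d} α E γ =
  (E γ × ¬ (α ⊆ᵈ γ)) ⊎
  (∃[ δ ] (¬ (α ⊆ᵈ δ) × E (α ++ δ) × (γ ≐ ((α ⁺) ∷ δ))))

-- Let M = max B_β and α = [M]⁺.  Two members of M that meet have their union in B_β,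
-- so by maximality M consists of pairwise disjoint sets covering β; hence β⁺ = α⁺.
-- Faithfulness of κ_X (with all coefficients 1) makes γ ↦ γ⁺ injective on C, so
-- α ⊆ [N]⁺ exactly when every member of M lies in N.
--
-- A nested set N of B ∪ {β} not containing β is nested for B, and cannot contain all
-- of M (M would reduce to an antichain with union β, or to β itself).  If β ∈ N, then
-- (N − β) ∪ M is nested for B, with [(N − β) ∪ M]⁺ = α ∪ [N − β]⁺.  Conversely a nested
-- set of B stays nested for B ∪ {β} unless an antichain has union β, which forces it to
-- contain M; and from N* nested for B with [N*]⁺ = α ∪ δ one gets the nested set
-- {β} ∪ {ν ∈ N* | ν⁺ ∈ δ}.  In each case an antichain involving β or M is traded for
-- one of the old nested set with the same union, by replacing β by M or conversely.

module Submission where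

open import Defs
open import Data.Nat as ℕ using (ℕ; _<_; _≤_; z≤n; s≤s)
import Data.Nat.Properties as ℕ
import Data.Nat.Coprimality as Coprimality
open import Data.Integer as ℤ using (+_)
import Data.Integer.Properties as ℤ
open import Data.Rational as ℚ using (0ℚ; 1ℚ)
import Data.Rational.Properties as ℚ
open import Data.Vec as Vec using (Vec; []; _∷_; replicate; zipWith)
import Data.Vec.Properties as Vec
open import Data.List using (List; []; _∷_; _++_; concat; map; foldr; deduplicate; filter; length)
import Data.List.Properties as List
open import Data.List.Membership.Propositional using (_∈_; find; lose)
open import Data.List.Membership.Propositional.Properties
open import Data.List.Membership.Propositional.Properties.WithK using (unique∧set⇒bag)
open import Data.List.Relation.Binary.BagAndSetEquality using (∼bag⇒↭)
open import Data.List.Relation.Binary.Disjoint.Propositional using (Disjoint)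
open import Data.List.Relation.Binary.Disjoint.Propositional.Properties using (concat⁺ʳ)
open import Data.List.Relation.Binary.Permutation.Propositional as ↭ using (_↭_)
open import Data.List.Relation.Binary.Permutation.Propositional.Properties.WithK using (dedup-++-↭)
open import Data.List.Relation.Binary.Subset.Propositional using (_⊆_)
open import Data.List.Relation.Binary.Subset.Propositional.Properties
  using (⊆-refl; ⊆-trans; ⊆-reflexive; map⁺; ∈-∷⁺ʳ)
open import Data.List.Relation.Unary.All as All using (All; []; _∷_; all?)
import Data.List.Relation.Unary.All.Properties as All
open import Data.List.Relation.Unary.Any as Any using (Any; here; there; any?)
import Data.List.Relation.Unary.Any.Properties as Any
open import Data.List.Relation.Unary.AllPairs as AllPairs using (AllPairs; []; _∷_)
import Data.List.Relation.Unary.AllPairs.Properties as AllPairs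
open import Data.List.Relation.Unary.Unique.Propositional using (Unique)
open import Data.List.Relation.Unary.Unique.DecPropositional.Properties using (deduplicate-!)
open import Data.Product using (∃-syntax; _×_; _,_; proj₁; proj₂)
open import Data.Sum as Sum using (_⊎_; inj₁; inj₂; [_,_]′)
open import Data.Empty using (⊥-elim)
open import Function using (_∘_; id)
open import Function.Bundles using (_⇔_; mk⇔)
open import Relation.Nullary using (¬_; ¬?; Dec; yes; no)
open import Relation.Nullary.Decidable using (_×-dec_)
open import Relation.Binary.PropositionalEquality using (_≡_; _≢_; refl; sym; trans; cong; cong₂; subst)
open Relation.Binary.PropositionalEquality.≡-Reasoning

module _ {a r s} {A : Set a} {R : A → A → Set r} {S : A → A → Set s} where

  AllPairs-map-∈ : {xs : List A} → (∀ {x y} → x ∈ xs → y ∈ xs → R x y → S x y) →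
                   AllPairs R xs → AllPairs S xs
  AllPairs-map-∈ f [] = []
  AllPairs-map-∈ f (Rx ∷ Rxs) =
    All.tabulate (λ y∈ → f (here refl) (there y∈) (All.lookup Rx y∈))
    ∷ AllPairs-map-∈ (λ x∈ y∈ → f (there x∈) (there y∈)) Rxs

module _ {d : ℕ} where

  ≐-refl : {s : FSet d} → s ≐ s
  ≐-refl = ⊆-refl , ⊆-refl

  ≐-sym : {s t : FSet d} → s ≐ t → t ≐ s
  ≐-sym (s⊆t , t⊆s) = t⊆s , s⊆t

  ≐-trans : {s t u : FSet d} → s ≐ t → t ≐ u → s ≐ u
  ≐-trans (s⊆t , t⊆s) (t⊆u , u⊆t) = ⊆-trans s⊆t t⊆u , ⊆-trans u⊆t t⊆s

  _≐?_ : (s t : FSet d) → Dec (s ≐ t)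
  s ≐? t = ⊆ᵈ? s t ×-dec ⊆ᵈ? t s

  _∈ᶠ?_ : (s : FSet d) (F : Fam d) → Dec (s ∈ᶠ F)
  s ∈ᶠ? F = any? (_≐? s) F

  ∈ᶠ-resp-≐ : {s t : FSet d} {F : Fam d} → s ≐ t → s ∈ᶠ F → t ∈ᶠ F
  ∈ᶠ-resp-≐ s≐t = Any.map (λ u≐s → ≐-trans u≐s s≐t)

  ∈⇒∈ᶠ : {s : FSet d} {F : Fam d} → s ∈ F → s ∈ᶠ F
  ∈⇒∈ᶠ = Any.map (λ { refl → ≐-refl })

  ⊆⇒⊆ᶠ : {F G : Fam d} → F ⊆ G → ∀ {s} → s ∈ᶠ F → s ∈ᶠ G
  ⊆⇒⊆ᶠ F⊆G s∈F with find s∈F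
  ... | t , t∈F , t≐s = ∈ᶠ-resp-≐ t≐s (∈⇒∈ᶠ (F⊆G t∈F))

  Incomp⇒≉ : {s t : FSet d} → Incomp s t → ¬ (s ≐ t)
  Incomp⇒≉ (s⊈t , _) (s⊆t , _) = s⊈t s⊆t

  ∈C-⊆ : {C : Complex d} {s t : FSet d} → s ⊆ᵈ t → t ∈C C → s ∈C C
  ∈C-⊆ s⊆t = Any.map (⊆-trans s⊆t)

  ⊆-concat : {A : Fam d} {s : FSet d} → s ∈ A → s ⊆ᵈ concat A
  ⊆-concat s∈A x∈s = ∈-concat⁺′ x∈s s∈A

  concat-lub : {A : Fam d} {t : FSet d} → (∀ {s} → s ∈ A → s ⊆ᵈ t) → concat A ⊆ᵈ t
  concat-lub {A} bound x∈ with ∈-concat⁻′ A x∈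
  ... | s , x∈s , s∈A = bound s∈A x∈s

  ++-lub : {s t u : FSet d} → s ⊆ᵈ u → t ⊆ᵈ u → (s ++ t) ⊆ᵈ u
  ++-lub {s} s⊆u t⊆u x∈ = [ s⊆u , t⊆u ]′ (∈-++⁻ s x∈)

  _⊆ᶠ_ : Fam d → Fam d → Set
  F ⊆ᶠ G = ∀ {s} → s ∈ F → s ∈ᶠ G

  All⇒⊆ᶠ : {F G : Fam d} → All (_∈ᶠ G) F → ∀ {s} → s ∈ᶠ F → s ∈ᶠ G
  All⇒⊆ᶠ F⊆G s∈F with find s∈F
  ... | t , t∈F , t≐s = ∈ᶠ-resp-≐ t≐s (All.lookup F⊆G t∈F)

  ∉ᶠ-∷ : {β s : FSet d} {X : Fam d} → ¬ (β ≐ s) → ¬ (s ∈ᶠ X) → ¬ (s ∈ᶠ (β ∷ X))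
  ∉ᶠ-∷ β≉s _   (here β≐s) = β≉s β≐s
  ∉ᶠ-∷ _   s∉X (there s∈X) = s∉X s∈X

  ∈ᶠ-∷⁻ : {β s : FSet d} {X : Fam d} → s ∈ᶠ (β ∷ X) → ¬ (β ≐ s) → s ∈ᶠ X
  ∈ᶠ-∷⁻ (here β≐s)  β≉s = ⊥-elim (β≉s β≐s)
  ∈ᶠ-∷⁻ (there s∈X) _   = s∈X

  ∈ᶠ-++⁻ʳ : {F G : Fam d} {s : FSet d} → s ∈ᶠ (F ++ G) → ¬ (s ∈ᶠ F) → s ∈ᶠ G
  ∈ᶠ-++⁻ʳ {F} s∈F++G s∉F = [ ⊥-elim ∘ s∉F , id ]′ (Any.++⁻ F s∈F++G)

module _ {d : ℕ} where

  infixl 6 _⊕_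
  _⊕_ : V d → V d → V d
  _⊕_ = zipWith ℕ._+_

  𝟘 : V d
  𝟘 = replicate d 0

  sumV : List (V d) → V d
  sumV = foldr _⊕_ 𝟘

  ⊕-assoc : (u v w : V d) → (u ⊕ v) ⊕ w ≡ u ⊕ (v ⊕ w)
  ⊕-assoc = Vec.zipWith-assoc ℕ.+-assoc

  ⊕-comm : (u v : V d) → u ⊕ v ≡ v ⊕ u
  ⊕-comm = Vec.zipWith-comm ℕ.+-comm

  ⊕-identityˡ : (u : V d) → 𝟘 ⊕ u ≡ u
  ⊕-identityˡ = Vec.zipWith-identityˡ ℕ.+-identityˡ

  sumV-↭ : {xs ys : List (V d)} → xs ↭ ys → sumV xs ≡ sumV ys
  sumV-↭ ↭.refl = refl
  sumV-↭ (↭.prep x p) = cong (x ⊕_) (sumV-↭ p)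
  sumV-↭ {x ∷ y ∷ xs} {_ ∷ _ ∷ ys} (↭.swap x y p) = begin
    x ⊕ (y ⊕ sumV xs) ≡⟨ cong (λ z → x ⊕ (y ⊕ z)) (sumV-↭ p) ⟩
    x ⊕ (y ⊕ sumV ys) ≡⟨ sym (⊕-assoc x y _) ⟩
    (x ⊕ y) ⊕ sumV ys ≡⟨ cong (_⊕ sumV ys) (⊕-comm x y) ⟩
    (y ⊕ x) ⊕ sumV ys ≡⟨ ⊕-assoc y x _ ⟩
    y ⊕ (x ⊕ sumV ys) ∎
  sumV-↭ (↭.trans p q) = trans (sumV-↭ p) (sumV-↭ q)

  sumV-++ : (xs ys : List (V d)) → sumV (xs ++ ys) ≡ sumV xs ⊕ sumV ys
  sumV-++ [] ys = sym (⊕-identityˡ (sumV ys))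
  sumV-++ (x ∷ xs) ys = begin
    x ⊕ sumV (xs ++ ys)     ≡⟨ cong (x ⊕_) (sumV-++ xs ys) ⟩
    x ⊕ (sumV xs ⊕ sumV ys) ≡⟨ sym (⊕-assoc x _ _) ⟩
    (x ⊕ sumV xs) ⊕ sumV ys ∎

  unique-≐⇒↭ : {xs ys : List (V d)} → Unique xs → Unique ys → xs ≐ ys → xs ↭ ys
  unique-≐⇒↭ xs! ys! (xs⊆ys , ys⊆xs) = ∼bag⇒↭ (unique∧set⇒bag xs! ys! (mk⇔ xs⊆ys ys⊆xs))

  ⁺-cong : {s t : FSet d} → s ≐ t → s ⁺ ≡ t ⁺
  ⁺-cong {s} {t} (s⊆t , t⊆s) = sumV-↭ (unique-≐⇒↭ (deduplicate-! _≟V_ s) (deduplicate-! _≟V_ t)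
    ( ∈-deduplicate⁺ _≟V_ ∘ s⊆t ∘ ∈-deduplicate⁻ _≟V_ s
    , ∈-deduplicate⁺ _≟V_ ∘ t⊆s ∘ ∈-deduplicate⁻ _≟V_ t))

  ⁺-unique : {xs : List (V d)} → Unique xs → xs ⁺ ≡ sumV xs
  ⁺-unique {xs} xs! = sumV-↭ (unique-≐⇒↭ (deduplicate-! _≟V_ xs) xs!
    (∈-deduplicate⁻ _≟V_ xs , ∈-deduplicate⁺ _≟V_))

  ⁺-concat : {L : Fam d} → AllPairs Disjoint L → concat L ⁺ ≡ sumV (map _⁺ L)
  ⁺-concat [] = refl
  ⁺-concat {s ∷ L} (s#L ∷ L#) = begin
    (s ++ concat L) ⁺  ≡⟨ sumV-↭ (dedup-++-↭ _≟V_ (concat⁺ʳ s#L)) ⟩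
    sumV (deduplicate _≟V_ s ++ deduplicate _≟V_ (concat L))
                       ≡⟨ sumV-++ (deduplicate _≟V_ s) _ ⟩
    s ⁺ ⊕ concat L ⁺   ≡⟨ cong (s ⁺ ⊕_) (⁺-concat L#) ⟩
    s ⁺ ⊕ sumV (map _⁺ L) ∎

  ∷-≐ : {v : V d} {s t : FSet d} → s ≐ t → (v ∷ s) ≐ (v ∷ t)
  ∷-≐ (s⊆t , t⊆s) = ∈-∷⁺ʳ (here refl) (there ∘ s⊆t) , ∈-∷⁺ʳ (here refl) (there ∘ t⊆s)

  []⁺-split : {N : Fam d} {β : FSet d} → β ∈ᶠ N →
              [ N ]⁺ ≐ (β ⁺ ∷ [ filter (λ s → ¬? (β ≐? s)) N ]⁺)
  []⁺-split {N} {β} β∈N = split , merge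
    where
    split : [ N ]⁺ ⊆ (β ⁺ ∷ [ filter (λ s → ¬? (β ≐? s)) N ]⁺)
    split v∈ with ∈-map⁻ _⁺ v∈
    ... | ν , ν∈N , refl with β ≐? ν
    ... | yes β≐ν = here (⁺-cong (≐-sym β≐ν))
    ... | no β≉ν  = there (∈-map⁺ _⁺ (∈-filter⁺ _ ν∈N β≉ν))
    merge : (β ⁺ ∷ [ filter (λ s → ¬? (β ≐? s)) N ]⁺) ⊆ [ N ]⁺
    merge (here refl) with find β∈N
    ... | β₀ , β₀∈N , β₀≐β = subst (_∈ [ N ]⁺) (⁺-cong β₀≐β) (∈-map⁺ _⁺ β₀∈N)
    merge (there v∈) = map⁺ _⁺ (proj₁ ∘ ∈-filter⁻ _) v∈

ℕ/1-+ : ∀ m n → (+ m ℚ./ 1) ℚ.+ (+ n ℚ./ 1) ≡ + (m ℕ.+ n) ℚ./ 1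
ℕ/1-+ m n = begin
  (+ m ℚ./ 1) ℚ.+ (+ n ℚ./ 1) ≡⟨ cong₂ ℚ._+_ (ℕ/1 m) (ℕ/1 n) ⟩
  (+ m ℤ.* + 1 ℤ.+ + n ℤ.* + 1) ℚ./ 1
                              ≡⟨ ℚ./-cong {p₁ = + m ℤ.* + 1 ℤ.+ + n ℤ.* + 1}
                                   (cong₂ ℤ._+_ (ℤ.*-identityʳ (+ m)) (ℤ.*-identityʳ (+ n))) refl ⟩
  + (m ℕ.+ n) ℚ./ 1           ∎
  where
  ℕ/1 : ∀ k → + k ℚ./ 1 ≡ ℚ.mkℚ (+ k) 0 (Coprimality.sym (Coprimality.1-coprimeTo k))
  ℕ/1 k = ℚ.normalize-coprime (Coprimality.sym (Coprimality.1-coprimeTo k))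

κ-⊕ : ∀ {n} (u v : Vec ℕ n) → κ (zipWith ℕ._+_ u v) ≡ zipWith ℚ._+_ (κ u) (κ v)
κ-⊕ [] [] = refl
κ-⊕ (x ∷ u) (y ∷ v) = cong₂ _∷_ (sym (ℕ/1-+ x y)) (κ-⊕ u v)

module _ {d : ℕ} where

  linComb-1 : (γ : FSet d) → linComb (λ _ → 1ℚ) γ ≡ κ (γ ⁺)
  linComb-1 γ = sum-κ (deduplicate _≟V_ γ)
    where
    sum-κ : (xs : List (V d)) →
         foldr (λ a acc → zipWith ℚ._+_ (Vec.map (1ℚ ℚ.*_) (κ a)) acc) (replicate d 0ℚ) xs ≡ κ (sumV xs)
    sum-κ [] = sym (Vec.map-replicate _ 0 d)
    sum-κ (x ∷ xs) = begin
      zipWith ℚ._+_ (Vec.map (1ℚ ℚ.*_) (κ x)) (foldr _ (replicate d 0ℚ) xs)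
        ≡⟨ cong₂ (zipWith ℚ._+_) (trans (Vec.map-cong ℚ.*-identityˡ (κ x)) (Vec.map-id (κ x))) (sum-κ xs) ⟩
      zipWith ℚ._+_ (κ x) (κ (sumV xs)) ≡⟨ sym (κ-⊕ x (sumV xs)) ⟩
      κ (x ⊕ sumV xs) ∎

  ⁺-injective : {C : Complex d} → FaithfullyRealizes C → {s t : FSet d} →
                s ∈C C → t ∈C C → s ⁺ ≡ t ⁺ → s ≐ t
  ⁺-injective faithful {s} {t} s∈C t∈C s⁺≡t⁺ =
    proj₁ (faithful s t s∈C t∈C (λ _ → 1ℚ) (λ _ → 1ℚ) (λ _ _ → 0<1) (λ _ _ → 0<1) (begin
      linComb (λ _ → 1ℚ) s ≡⟨ linComb-1 s ⟩
      κ (s ⁺)              ≡⟨ cong κ s⁺≡t⁺ ⟩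
      κ (t ⁺)              ≡⟨ sym (linComb-1 t) ⟩
      linComb (λ _ → 1ℚ) t ∎))
    where
    0<1 : 0ℚ ℚ.< 1ℚ
    0<1 = ℚ.*<* (ℤ.+<+ (s≤s z≤n))

module _ {d : ℕ} where

  _⊊_ : FSet d → FSet d → Set
  s ⊊ t = s ⊆ᵈ t × ¬ (t ⊆ᵈ s)

  Maximal : Fam d → FSet d → Set
  Maximal Z μ = ¬ Any (μ ⊊_) Z

  ∈-maxF⁻ : {Z : Fam d} {μ : FSet d} → μ ∈ maxF Z → μ ∈ Z × Maximal Z μ
  ∈-maxF⁻ {Z} = ∈-filter⁻ (λ δ → ¬? (any? (λ ε → ⊆ᵈ? δ ε ×-dec ¬? (⊆ᵈ? ε δ)) Z))

  ∈-maxF⁺ : {Z : Fam d} {μ : FSet d} → μ ∈ Z → Maximal Z μ → μ ∈ maxF Z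
  ∈-maxF⁺ {Z} = ∈-filter⁺ (λ δ → ¬? (any? (λ ε → ⊆ᵈ? δ ε ×-dec ¬? (⊆ᵈ? ε δ)) Z))

  ⊆-resp-¬⊊ : {c r w : FSet d} → c ⊆ᵈ r → ¬ (c ⊊ w) → ¬ (r ⊊ w)
  ⊆-resp-¬⊊ c⊆r c⊀w (r⊆w , w⊈r) = c⊀w (⊆-trans c⊆r r⊆w , λ w⊆c → w⊈r (⊆-trans w⊆c c⊆r))

  -- One pass through Z, moving up whenever a strictly larger member is met; a member
  -- passed over stays not-above the current candidate, as candidates only grow.
  climb : (c : FSet d) (Z : Fam d) →
          ∃[ r ] (c ⊆ᵈ r × (r ≡ c ⊎ r ∈ Z) × All (λ w → ¬ (r ⊊ w)) Z)
  climb c [] = c , ⊆-refl , inj₁ refl , []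
  climb c (z ∷ Z) with ⊆ᵈ? c z ×-dec ¬? (⊆ᵈ? z c)
  ... | yes (c⊆z , _) =
    let r , z⊆r , r∈ , r⊀Z = climb z Z in
    r , ⊆-trans c⊆z z⊆r , inj₂ ([ here , there ]′ r∈) ,
    (λ (_ , z⊈r) → z⊈r z⊆r) ∷ r⊀Z
  ... | no c⊀z =
    let r , c⊆r , r∈ , r⊀Z = climb c Z in
    r , c⊆r , Sum.map id there r∈ , ⊆-resp-¬⊊ c⊆r c⊀z ∷ r⊀Z

  maxF-above : {Z : Fam d} {ε : FSet d} → ε ∈ Z → ∃[ μ ] (μ ∈ maxF Z × ε ⊆ᵈ μ)
  maxF-above {Z} {ε} ε∈Z with climb ε Z
  ... | r , ε⊆r , r∈ , r⊀Z =
    r , ∈-maxF⁺ ([ (λ r≡ε → subst (_∈ Z) (sym r≡ε) ε∈Z) , id ]′ r∈) (All.All¬⇒¬Any r⊀Z) , ε⊆r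

  EqualOrIncomp : Fam d → Set
  EqualOrIncomp L = ∀ {s t} → s ∈ L → t ∈ L → s ≐ t ⊎ Incomp s t

  maxF-equalOrIncomp : (Z : Fam d) → EqualOrIncomp (maxF Z)
  maxF-equalOrIncomp Z {μ} {ν} μ∈ ν∈ with ⊆ᵈ? μ ν | ⊆ᵈ? ν μ
  ... | yes μ⊆ν | yes ν⊆μ = inj₁ (μ⊆ν , ν⊆μ)
  ... | no μ⊈ν  | no ν⊈μ  = inj₂ (μ⊈ν , ν⊈μ)
  ... | yes μ⊆ν | no ν⊈μ  =
    ⊥-elim (proj₂ (∈-maxF⁻ {Z} μ∈) (lose {P = μ ⊊_} (proj₁ (∈-maxF⁻ {Z} ν∈)) (μ⊆ν , ν⊈μ)))
  ... | no μ⊈ν  | yes ν⊆μ =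
    ⊥-elim (proj₂ (∈-maxF⁻ {Z} ν∈) (lose {P = ν ⊊_} (proj₁ (∈-maxF⁻ {Z} μ∈)) (ν⊆μ , μ⊈ν)))

  deduplicate-incomp : (L : Fam d) → EqualOrIncomp L → AllPairs Incomp (deduplicate _≐?_ L)
  deduplicate-incomp [] _ = []
  deduplicate-incomp (s ∷ L) s∷L-eoi =
    All.tabulate incomp-s ∷ AllPairs.filter⁺ _ (deduplicate-incomp L (λ t∈ u∈ → s∷L-eoi (there t∈) (there u∈)))
    where
    incomp-s : ∀ {t} → t ∈ filter (¬? ∘ (s ≐?_)) (deduplicate _≐?_ L) → Incomp s t
    incomp-s t∈ with ∈-filter⁻ (¬? ∘ (s ≐?_)) t∈
    ... | t∈′ , s≉t = [ ⊥-elim ∘ s≉t , id ]′ (s∷L-eoi (here refl) (there (∈-deduplicate⁻ _≐?_ L t∈′)))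

  record Reduct (L : Fam d) : Set where
    field
      members   : Fam d
      ⊆-family  : members ⊆ L
      antichain : AllPairs Incomp members
      dominates : ∀ {s} → s ∈ L → ∃[ t ] (t ∈ members × s ⊆ᵈ t)

    concat-members : concat members ≐ concat L
    concat-members =
      concat-lub (⊆-concat ∘ ⊆-family) ,
      concat-lub (λ s∈L → let _ , t∈ , s⊆t = dominates s∈L in ⊆-trans s⊆t (⊆-concat t∈))

  reduct : (L : Fam d) → Reduct L
  reduct L = record
    { members   = deduplicate _≐?_ (maxF L)
    ; ⊆-family  = proj₁ ∘ ∈-maxF⁻ ∘ ∈-deduplicate⁻ _≐?_ (maxF L)
    ; antichain = deduplicate-incomp (maxF L) (maxF-equalOrIncomp L)
    ; dominates = dominates
    }
    where
    dominates : ∀ {s} → s ∈ L → ∃[ t ] (t ∈ deduplicate _≐?_ (maxF L) × s ⊆ᵈ t)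
    dominates s∈L with maxF-above s∈L
    ... | μ , μ∈ , s⊆μ with find (Any.deduplicate⁺ _≐?_ (λ u≐t μ≐t → ≐-trans μ≐t (≐-sym u≐t))
                                     (lose μ∈ ≐-refl))
    ... | t , t∈ , μ≐t = t , t∈ , ⊆-trans s⊆μ (proj₁ μ≐t)

  antichain-⊆⇒≡ : {A : Fam d} {s t : FSet d} → AllPairs Incomp A → s ∈ A → t ∈ A → s ⊆ᵈ t → s ≡ t
  antichain-⊆⇒≡ _          (here refl) (here refl) _   = refl
  antichain-⊆⇒≡ (s# ∷ _)   (here refl) (there t∈)  s⊆t = ⊥-elim (proj₁ (All.lookup s# t∈) s⊆t)
  antichain-⊆⇒≡ (t# ∷ _)   (there s∈)  (here refl) s⊆t = ⊥-elim (proj₂ (All.lookup t# s∈) s⊆t)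
  antichain-⊆⇒≡ (_ ∷ A#)   (there s∈)  (there t∈)  s⊆t = antichain-⊆⇒≡ A# s∈ t∈ s⊆t

  antichain-no-greatest : {A : Fam d} {s : FSet d} → AllPairs Incomp A → 2 ≤ length A →
                          s ∈ A → ¬ (concat A ⊆ᵈ s)
  antichain-no-greatest {A@(x ∷ y ∷ _)} A#@((x#y ∷ _) ∷ _) _ s∈A A⊆s
    with antichain-⊆⇒≡ A# (here refl) s∈A (⊆-trans (⊆-concat {A = A} (here refl)) A⊆s)
       | antichain-⊆⇒≡ A# (there (here refl)) s∈A (⊆-trans (⊆-concat {A = A} (there (here refl))) A⊆s)
  ... | refl | refl = proj₁ x#y ⊆-refl
  antichain-no-greatest {_ ∷ []} _ (s≤s ()) _ _

  AntichainOrGreatest : Fam d → Fam d → Set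
  AntichainOrGreatest K L =
    (∃[ A ] (IsAntichain K A × concat A ≐ concat L)) ⊎ (∃[ s ] (s ∈ L × concat L ⊆ᵈ s))

  antichain-or-greatest : {K L : Fam d} {s₀ : FSet d} → s₀ ∈ L → L ⊆ᶠ K →
                          AntichainOrGreatest K L
  antichain-or-greatest {K} {L} s₀∈L L⊆K = cases (reduct L)
    where
    cases : Reduct L → AntichainOrGreatest K L
    cases record { members = [] ; dominates = dom } with dom s₀∈L
    ... | _ , () , _
    cases record { members = t ∷ [] ; ⊆-family = ⊆L ; dominates = dom } =
      inj₂ (t , ⊆L (here refl) , concat-lub (λ s∈L → below-t (dom s∈L)))
      where
      below-t : ∀ {s} → ∃[ u ] (u ∈ t ∷ [] × s ⊆ᵈ u) → s ⊆ᵈ t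
      below-t (_ , here refl , s⊆t) = s⊆t
    cases r@record { members = A@(_ ∷ _ ∷ _) ; ⊆-family = ⊆L ; antichain = A# } =
      inj₁ (A , (All.tabulate (L⊆K ∘ ⊆L) , s≤s (s≤s z≤n) , A#) , Reduct.concat-members r)

  IsAntichain-mono : {K K′ A : Fam d} → (∀ {s} → s ∈ᶠ K → s ∈ᶠ K′) → IsAntichain K A → IsAntichain K′ A
  IsAntichain-mono K⊆K′ (A⊆K , len , A#) = All.map K⊆K′ A⊆K , len , A#

nonempty-length : {A : Set} {x : A} {xs : List A} → x ∈ xs → 1 ≤ length xs
nonempty-length (here _)  = s≤s z≤n
nonempty-length (there _) = s≤s z≤n

-- IsNested C X N unfolds to All (_∈ᶠ X) N × UnionsOutside C X N.
UnionsOutside : ∀ {d} → Complex d → Fam d → Fam d → Set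
UnionsOutside C X N = ∀ A → IsAntichain N A → (concat A ∈C C) × ¬ (concat A ∈ᶠ X)

module _ {d : ℕ} {C : Complex d} where

  UnionsOutside-⊆ : {X N N′ : Fam d} → N ⊆ N′ → UnionsOutside C X N′ → UnionsOutside C X N
  UnionsOutside-⊆ N⊆N′ outside A A-ac = outside A (IsAntichain-mono (⊆⇒⊆ᶠ N⊆N′) A-ac)

  UnionsOutside-∷⁻ : {β : FSet d} {X N : Fam d} → UnionsOutside C (β ∷ X) N → UnionsOutside C X N
  UnionsOutside-∷⁻ outside A A-ac = proj₁ (outside A A-ac) , proj₂ (outside A A-ac) ∘ there

module BuildingSet {d : ℕ} (C : Complex d) (X : Fam d) (building : IsBuildingSet C X) where

  ∈X⇒∈C : {δ : FSet d} → δ ∈ᶠ X → δ ∈C C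
  ∈X⇒∈C {δ} = proj₁ building δ

  ∈X⇒nonempty : {δ : FSet d} → δ ∈ᶠ X → ∃[ x ] (x ∈ δ)
  ∈X⇒nonempty {δ} δ∈X with All.lookupAny (proj₂ building) (∈X⇒∈C δ∈X)
  ... | (all-nonempty , _ , _) , δ⊆α = all-nonempty δ δ∈X δ⊆α

  ∪-closed : {δ ε : FSet d} → δ ∈ᶠ X → ε ∈ᶠ X → (δ ++ ε) ∈C C →
             ∃[ x ] (x ∈ δ × x ∈ ε) → (δ ++ ε) ∈ᶠ X
  ∪-closed {δ} {ε} δ∈X ε∈X δ∪ε∈C δ∩ε with All.lookupAny (proj₂ building) δ∪ε∈C
  ... | (_ , B1 , _) , δ∪ε⊆α = B1 δ ε δ∈X (δ∪ε⊆α ∘ ∈-++⁺ˡ) ε∈X (δ∪ε⊆α ∘ ∈-++⁺ʳ δ) δ∩ε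

  singleton : {γ : FSet d} {a : V d} → γ ∈C C → a ∈ γ → (a ∷ []) ∈ᶠ X
  singleton γ∈C a∈γ with All.lookupAny (proj₂ building) γ∈C
  ... | (_ , _ , B2) , γ⊆α = B2 _ (γ⊆α a∈γ)

module Blowup {d : ℕ} (C : Complex d) (faithful : FaithfullyRealizes C) (B : Fam d) (β : FSet d)
              (building : IsBuildingSet C B) (building-β : IsBuildingSet C (β ∷ B)) where

  private
    module B = BuildingSet C B building
    module βB = BuildingSet C (β ∷ B) building-β
    open import Data.List.Membership.DecPropositional (_≟V_ {d}) using (_∈?_)

  M : Fam d
  M = maxF (restrict B β)

  α : FSet d
  α = [ M ]⁺

  β∈C : β ∈C C
  β∈C = βB.∈X⇒∈C (here ≐-refl)

  record MaxBelowβ (μ : FSet d) : Set where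
    field
      ∈B      : μ ∈ᶠ B
      ⊆β      : μ ⊆ᵈ β
      maximal : ∀ {ε} → ε ∈ᶠ B → ε ⊆ᵈ β → μ ⊆ᵈ ε → ε ⊆ᵈ μ

  open MaxBelowβ

  M⇒MaxBelowβ : {μ : FSet d} → μ ∈ M → MaxBelowβ μ
  M⇒MaxBelowβ {μ} μ∈M with ∈-maxF⁻ μ∈M
  ... | μ∈B∩β , μ-maximal with ∈-filter⁻ (λ δ → ⊆ᵈ? δ β) μ∈B∩β
  ... | μ∈B , μ⊆β = record { ∈B = ∈⇒∈ᶠ μ∈B ; ⊆β = μ⊆β ; maximal = max }
    where
    max : ∀ {ε} → ε ∈ᶠ B → ε ⊆ᵈ β → μ ⊆ᵈ ε → ε ⊆ᵈ μ
    max ε∈B ε⊆β μ⊆ε with find ε∈B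
    ... | ε′ , ε′∈B , ε′≐ε with ⊆ᵈ? ε′ μ
    ... | yes ε′⊆μ = ⊆-trans (proj₂ ε′≐ε) ε′⊆μ
    ... | no ε′⊈μ = ⊥-elim (μ-maximal
          (lose (∈-filter⁺ (λ δ → ⊆ᵈ? δ β) ε′∈B (⊆-trans (proj₁ ε′≐ε) ε⊆β))
                (⊆-trans μ⊆ε (proj₂ ε′≐ε) , ε′⊈μ)))

  MaxBelowβ-resp-≐ : {μ ν : FSet d} → μ ≐ ν → MaxBelowβ μ → MaxBelowβ ν
  MaxBelowβ-resp-≐ (μ⊆ν , ν⊆μ) max = record
    { ∈B      = ∈ᶠ-resp-≐ (μ⊆ν , ν⊆μ) (∈B max)
    ; ⊆β      = ⊆-trans ν⊆μ (⊆β max)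
    ; maximal = λ ε∈B ε⊆β ν⊆ε → ⊆-trans (maximal max ε∈B ε⊆β (⊆-trans μ⊆ν ν⊆ε)) μ⊆ν
    }

  ∈ᶠM⇒MaxBelowβ : {μ : FSet d} → μ ∈ᶠ M → MaxBelowβ μ
  ∈ᶠM⇒MaxBelowβ μ∈M with find μ∈M
  ... | μ₀ , μ₀∈M , μ₀≐μ = MaxBelowβ-resp-≐ μ₀≐μ (M⇒MaxBelowβ μ₀∈M)

  MaxBelowβ⇒∈C : {μ : FSet d} → MaxBelowβ μ → μ ∈C C
  MaxBelowβ⇒∈C = B.∈X⇒∈C ∘ ∈B

  -- μ ∪ ν is again a member of B below β, so maximality of ν absorbs it.
  MaxBelowβ-overlap⇒⊆ : {μ ν : FSet d} {x : V d} → MaxBelowβ μ → MaxBelowβ ν →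
                        x ∈ μ → x ∈ ν → μ ⊆ᵈ ν
  MaxBelowβ-overlap⇒⊆ {μ} {ν} max-μ max-ν x∈μ x∈ν =
    ⊆-trans ∈-++⁺ˡ (maximal max-ν μ∪ν∈B μ∪ν⊆β (∈-++⁺ʳ μ))
    where
    μ∪ν⊆β : (μ ++ ν) ⊆ᵈ β
    μ∪ν⊆β = ++-lub (⊆β max-μ) (⊆β max-ν)
    μ∪ν∈B : (μ ++ ν) ∈ᶠ B
    μ∪ν∈B = B.∪-closed (∈B max-μ) (∈B max-ν) (∈C-⊆ {C = C} μ∪ν⊆β β∈C) (_ , x∈μ , x∈ν)

  M-above : {ε : FSet d} → ε ∈ᶠ B → ε ⊆ᵈ β → ∃[ μ ] (μ ∈ M × ε ⊆ᵈ μ)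
  M-above ε∈B ε⊆β with find ε∈B
  ... | ε′ , ε′∈B , ε′≐ε with maxF-above (∈-filter⁺ (λ δ → ⊆ᵈ? δ β) ε′∈B (⊆-trans (proj₁ ε′≐ε) ε⊆β))
  ... | μ , μ∈M , ε′⊆μ = μ , μ∈M , ⊆-trans (proj₂ ε′≐ε) ε′⊆μ

  M-covers : {x : V d} → x ∈ β → ∃[ μ ] (μ ∈ M × x ∈ μ)
  M-covers x∈β with M-above (B.singleton β∈C x∈β) (λ { (here refl) → x∈β })
  ... | μ , μ∈M , x⊆μ = μ , μ∈M , x⊆μ (here refl)

  concat-M : concat M ≐ β
  concat-M = concat-lub (⊆β ∘ M⇒MaxBelowβ) ,
             λ x∈β → let μ , μ∈M , x∈μ = M-covers x∈β in ⊆-concat μ∈M x∈μ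

  M-nonempty : ∃[ μ ] (μ ∈ M)
  M-nonempty = let μ , μ∈M , _ = M-covers (proj₂ (βB.∈X⇒nonempty (here ≐-refl))) in μ , μ∈M

  β⁺≡α⁺ : β ⁺ ≡ α ⁺
  β⁺≡α⁺ = begin
    β ⁺               ≡⟨ ⁺-cong (≐-trans (≐-sym concat-M) (≐-sym concat-members)) ⟩
    concat R ⁺        ≡⟨ ⁺-concat (AllPairs-map-∈ disjoint antichain) ⟩
    sumV (map _⁺ R)   ≡⟨ sym (⁺-unique (AllPairs.map⁺ (AllPairs-map-∈ distinct⁺ antichain))) ⟩
    [ R ]⁺ ⁺          ≡⟨ ⁺-cong [R]⁺≐α ⟩
    α ⁺               ∎
    where
    open Reduct (reduct M) renaming (members to R)
    R⇒MaxBelowβ : {t : FSet d} → t ∈ R → MaxBelowβ t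
    R⇒MaxBelowβ = M⇒MaxBelowβ ∘ ⊆-family
    disjoint : {t u : FSet d} → t ∈ R → u ∈ R → Incomp t u → Disjoint t u
    disjoint t∈R u∈R t#u (x∈t , x∈u) =
      proj₁ t#u (MaxBelowβ-overlap⇒⊆ (R⇒MaxBelowβ t∈R) (R⇒MaxBelowβ u∈R) x∈t x∈u)
    distinct⁺ : {t u : FSet d} → t ∈ R → u ∈ R → Incomp t u → t ⁺ ≢ u ⁺
    distinct⁺ t∈R u∈R t#u = Incomp⇒≉ t#u ∘
      ⁺-injective {C = C} faithful (MaxBelowβ⇒∈C (R⇒MaxBelowβ t∈R)) (MaxBelowβ⇒∈C (R⇒MaxBelowβ u∈R))
    [R]⁺≐α : [ R ]⁺ ≐ α
    [R]⁺≐α = map⁺ _⁺ ⊆-family , ⊇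
      where
      ⊇ : α ⊆ [ R ]⁺
      ⊇ v∈α with ∈-map⁻ _⁺ v∈α
      ... | μ , μ∈M , refl with dominates μ∈M
      ... | t , t∈R , μ⊆t =
        subst (_∈ [ R ]⁺) (⁺-cong (maximal max-μ (∈B max-t) (⊆β max-t) μ⊆t , μ⊆t)) (∈-map⁺ _⁺ t∈R)
        where
        max-μ : MaxBelowβ μ
        max-μ = M⇒MaxBelowβ μ∈M
        max-t : MaxBelowβ t
        max-t = R⇒MaxBelowβ t∈R

  α⊆⇒M⊆ᶠ : {K : Fam d} → (∀ {s} → s ∈ K → s ∈C C) → α ⊆ᵈ [ K ]⁺ → M ⊆ᶠ K
  α⊆⇒M⊆ᶠ K⊆C α⊆[K]⁺ μ∈M with ∈-map⁻ _⁺ (α⊆[K]⁺ (∈-map⁺ _⁺ μ∈M))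
  ... | ν , ν∈K , μ⁺≡ν⁺ =
    ∈ᶠ-resp-≐ (≐-sym (⁺-injective {C = C} faithful (MaxBelowβ⇒∈C (M⇒MaxBelowβ μ∈M)) (K⊆C ν∈K) μ⁺≡ν⁺))
              (∈⇒∈ᶠ ν∈K)

  M⊆ᶠ⇒α⊆ : {K : Fam d} → M ⊆ᶠ K → α ⊆ᵈ [ K ]⁺
  M⊆ᶠ⇒α⊆ {K} M⊆K v∈α with ∈-map⁻ _⁺ v∈α
  ... | μ , μ∈M , refl with find (M⊆K μ∈M)
  ... | ν , ν∈K , ν≐μ = subst (_∈ [ K ]⁺) (⁺-cong ν≐μ) (∈-map⁺ _⁺ ν∈K)

  M⊆ᶠ⇒β∈ᶠ : (K : Fam d) → (∀ A → IsAntichain K A → ¬ (β ≐ concat A)) → M ⊆ᶠ K → β ∈ᶠ K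
  M⊆ᶠ⇒β∈ᶠ K no-union-β M⊆K with antichain-or-greatest (proj₂ M-nonempty) M⊆K
  ... | inj₁ (A , A-ac , A≐M) = ⊥-elim (no-union-β A A-ac (≐-trans (≐-sym concat-M) (≐-sym A≐M)))
  ... | inj₂ (s , s∈M , M⊆s) =
    ∈ᶠ-resp-≐ (⊆β (M⇒MaxBelowβ s∈M) , ⊆-trans (proj₂ concat-M) M⊆s) (M⊆K s∈M)

  -- Every μ ∈ M is the union of the members of A below it; these cannot form an
  -- antichain, as μ ∈ B, so one of them is μ itself.
  union-β⇒M⊆ᶠ : (K : Fam d) → All (_∈ᶠ B) K → UnionsOutside C B K →
                (A : Fam d) → IsAntichain K A → concat A ≐ β → M ⊆ᶠ K
  union-β⇒M⊆ᶠ K K⊆B K-outside A (A⊆K , _) A≐β {μ} μ∈M =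
    [ no-antichain , greatest-is-μ ]′
      (antichain-or-greatest (proj₁ (proj₂ (below (proj₂ (B.∈X⇒nonempty (∈B max-μ)))))) Aμ⊆K)
    where
    max-μ : MaxBelowβ μ
    max-μ = M⇒MaxBelowβ μ∈M
    ⊆μ? : (ε : FSet d) → Dec (ε ⊆ᵈ μ)
    ⊆μ? ε = ⊆ᵈ? ε μ
    Aμ : Fam d
    Aμ = filter ⊆μ? A
    Aμ⊆K : Aμ ⊆ᶠ K
    Aμ⊆K = All.lookup A⊆K ∘ proj₁ ∘ ∈-filter⁻ ⊆μ? {xs = A}
    below : ∀ {x} → x ∈ μ → ∃[ ε ] (ε ∈ Aμ × x ∈ ε)
    below x∈μ with ∈-concat⁻′ A (proj₂ A≐β (⊆β max-μ x∈μ))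
    ... | ε , x∈ε , ε∈A with M-above (All⇒⊆ᶠ K⊆B (All.lookup A⊆K ε∈A)) (⊆-trans (⊆-concat ε∈A) (proj₁ A≐β))
    ... | ν , ν∈M , ε⊆ν =
      ε , ∈-filter⁺ ⊆μ? ε∈A (⊆-trans ε⊆ν (MaxBelowβ-overlap⇒⊆ (M⇒MaxBelowβ ν∈M) max-μ (ε⊆ν x∈ε) x∈μ)) , x∈ε
    Aμ≐μ : concat Aμ ≐ μ
    Aμ≐μ = concat-lub (proj₂ ∘ ∈-filter⁻ ⊆μ? {xs = A}) ,
           λ x∈μ → let ε , ε∈Aμ , x∈ε = below x∈μ in ⊆-concat ε∈Aμ x∈ε
    no-antichain : ∃[ A′ ] (IsAntichain K A′ × concat A′ ≐ concat Aμ) → μ ∈ᶠ K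
    no-antichain (A′ , A′-ac , A′≐Aμ) =
      ⊥-elim (proj₂ (K-outside A′ A′-ac) (∈ᶠ-resp-≐ (≐-sym (≐-trans A′≐Aμ Aμ≐μ)) (∈B max-μ)))
    greatest-is-μ : ∃[ s ] (s ∈ Aμ × concat Aμ ⊆ᵈ s) → μ ∈ᶠ K
    greatest-is-μ (s , s∈Aμ , Aμ⊆s) =
      ∈ᶠ-resp-≐ (proj₂ (∈-filter⁻ ⊆μ? {xs = A} s∈Aμ) , ⊆-trans (proj₂ Aμ≐μ) Aμ⊆s) (Aμ⊆K s∈Aμ)

  union-⊆β-outside : {A : Fam d} {μ : FSet d} → AllPairs Incomp A → 2 ≤ length A → μ ∈ A →
                     MaxBelowβ μ → concat A ⊆ᵈ β → (concat A ∈C C) × ¬ (concat A ∈ᶠ B)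
  union-⊆β-outside A# len μ∈A max-μ A⊆β =
    ∈C-⊆ {C = C} A⊆β β∈C ,
    λ A∈B → antichain-no-greatest A# len μ∈A (maximal max-μ A∈B A⊆β (⊆-concat μ∈A))

  -- The members of A sticking out of β, together with β, form an antichain of N′
  -- whose union is that of A with β added.
  union-⊈β-outside : {N′ A : Fam d} {μ δ : FSet d} → UnionsOutside C (β ∷ B) N′ → β ∈ᶠ N′ →
    AllPairs Incomp A → μ ∈ A → MaxBelowβ μ → δ ∈ A → ¬ (δ ⊆ᵈ β) →
    (∀ {ε} → ε ∈ A → ¬ (ε ⊆ᵈ β) → ε ∈ᶠ N′) → (concat A ∈C C) × ¬ (concat A ∈ᶠ B)
  union-⊈β-outside {N′} {A} N′-outside β∈N′ A# μ∈A max-μ δ∈A δ⊈β ⊈β⇒∈N′ =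
    ∈C-⊆ {C = C} A⊆U U∈C , A∉B
    where
    ⊈β? : (ε : FSet d) → Dec (¬ (ε ⊆ᵈ β))
    ⊈β? ε = ¬? (⊆ᵈ? ε β)
    Aout : Fam d
    Aout = filter ⊈β? A
    Aout⊆A : Aout ⊆ A
    Aout⊆A = proj₁ ∘ ∈-filter⁻ ⊈β? {xs = A}
    Aout⊈β : ∀ {ε} → ε ∈ Aout → ¬ (ε ⊆ᵈ β)
    Aout⊈β = proj₂ ∘ ∈-filter⁻ ⊈β? {xs = A}
    β#Aout : ∀ {ε} → ε ∈ Aout → Incomp β ε
    β#Aout ε∈ =
      (λ β⊆ε → Aout⊈β ε∈ (subst (_⊆ᵈ β) (antichain-⊆⇒≡ A# μ∈A (Aout⊆A ε∈) (⊆-trans (⊆β max-μ) β⊆ε))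
                                 (⊆β max-μ))) ,
      Aout⊈β ε∈
    β∷Aout-ac : IsAntichain N′ (β ∷ Aout)
    β∷Aout-ac = (β∈N′ ∷ All.tabulate (λ ε∈ → ⊈β⇒∈N′ (Aout⊆A ε∈) (Aout⊈β ε∈))) ,
                s≤s (nonempty-length (∈-filter⁺ ⊈β? δ∈A δ⊈β)) ,
                All.tabulate β#Aout ∷ AllPairs.filter⁺ ⊈β? A#
    U : FSet d
    U = concat (β ∷ Aout)
    U∈C : U ∈C C
    U∈C = proj₁ (N′-outside _ β∷Aout-ac)
    member⊆U : ∀ {ε} → ε ∈ A → Dec (ε ⊆ᵈ β) → ε ⊆ᵈ U
    member⊆U _   (yes ε⊆β) = ⊆-trans ε⊆β ∈-++⁺ˡ
    member⊆U ε∈A (no ε⊈β)  = ⊆-trans (⊆-concat (∈-filter⁺ ⊈β? ε∈A ε⊈β)) (∈-++⁺ʳ β)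
    A⊆U : concat A ⊆ᵈ U
    A⊆U = concat-lub (λ {ε} ε∈A → member⊆U ε∈A (⊆ᵈ? ε β))
    A∪β≐U : (concat A ++ β) ≐ U
    A∪β≐U = ++-lub A⊆U ∈-++⁺ˡ ,
            ++-lub (∈-++⁺ʳ (concat A)) (⊆-trans (concat-lub (⊆-concat ∘ Aout⊆A)) ∈-++⁺ˡ)
    A∉B : ¬ (concat A ∈ᶠ B)
    A∉B A∈B with B.∈X⇒nonempty (∈B max-μ)
    ... | x , x∈μ = proj₂ (N′-outside _ β∷Aout-ac) (∈ᶠ-resp-≐ A∪β≐U
      (βB.∪-closed (there A∈B) (here ≐-refl) (∈C-⊆ {C = C} (proj₁ A∪β≐U) U∈C)
                   (x , ⊆-concat μ∈A x∈μ , ⊆β max-μ x∈μ)))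

  M++N-outside : {N′ N : Fam d} → UnionsOutside C (β ∷ B) N′ → β ∈ᶠ N′ → N ⊆ N′ →
                 UnionsOutside C B (M ++ N)
  M++N-outside N′-outside β∈N′ N⊆N′ A (A⊆M++N , len , A#) with any? (_∈ᶠ? M) A
  ... | no no-M = UnionsOutside-∷⁻ {C = C} {β = β} N′-outside A
                    (All.tabulate (λ ε∈A → ⊆⇒⊆ᶠ N⊆N′ (∈ᶠ-++⁻ʳ (All.lookup A⊆M++N ε∈A) (no-M ∘ lose ε∈A))) , len , A#)
  ... | yes has-M with find has-M
  ... | μ , μ∈A , μ∈M with all? (λ ε → ⊆ᵈ? ε β) A
  ... | yes A⊆β = union-⊆β-outside A# len μ∈A (∈ᶠM⇒MaxBelowβ μ∈M) (concat-lub (All.lookup A⊆β))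
  ... | no A⊈β with find (All.¬All⇒Any¬ (λ ε → ⊆ᵈ? ε β) A A⊈β)
  ... | δ , δ∈A , δ⊈β = union-⊈β-outside N′-outside β∈N′ A# μ∈A (∈ᶠM⇒MaxBelowβ μ∈M) δ∈A δ⊈β
                          (λ ε∈A ε⊈β → ⊆⇒⊆ᶠ N⊆N′ (∈ᶠ-++⁻ʳ (All.lookup A⊆M++N ε∈A) (ε⊈β ∘ ⊆β ∘ ∈ᶠM⇒MaxBelowβ)))

  -- Replacing β ∈ A by the members of M leaves the union unchanged.
  union-via-β-outside : {N* N A : Fam d} {β₀ : FSet d} → UnionsOutside C B N* → M ⊆ᶠ N* → N ⊆ N* →
    All (_∈ᶠ (β ∷ N)) A → 2 ≤ length A → AllPairs Incomp A → β₀ ∈ A → β ≐ β₀ →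
    (concat A ∈C C) × ¬ (concat A ∈ᶠ (β ∷ B))
  union-via-β-outside {N*} {A = A} N*-outside M⊆N* N⊆N* A⊆β∷N len A# β₀∈A β≐β₀ =
    [ from-antichain , ⊥-elim ∘ no-greatest ]′
      (antichain-or-greatest (∈-++⁺ʳ A₁ (proj₂ M-nonempty)) L⊆N*)
    where
    ≉β? : (ε : FSet d) → Dec (¬ (β ≐ ε))
    ≉β? ε = ¬? (β ≐? ε)
    A₁ : Fam d
    A₁ = filter ≉β? A
    L : Fam d
    L = A₁ ++ M
    A₁⊆A : A₁ ⊆ A
    A₁⊆A = proj₁ ∘ ∈-filter⁻ ≉β? {xs = A}
    A₁≉β : ∀ {ε} → ε ∈ A₁ → ¬ (β ≐ ε)
    A₁≉β = proj₂ ∘ ∈-filter⁻ ≉β? {xs = A}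
    A₁#β : ∀ {ε} → ε ∈ A₁ → Incomp ε β
    A₁#β ε∈ =
      (λ ε⊆β → A₁≉β ε∈ (subst (β ≐_) (sym (antichain-⊆⇒≡ A# (A₁⊆A ε∈) β₀∈A (⊆-trans ε⊆β (proj₁ β≐β₀))))
                                     β≐β₀)) ,
      (λ β⊆ε → A₁≉β ε∈ (subst (β ≐_) (antichain-⊆⇒≡ A# β₀∈A (A₁⊆A ε∈) (⊆-trans (proj₂ β≐β₀) β⊆ε))
                                     β≐β₀))
    L⊆N* : L ⊆ᶠ N*
    L⊆N* ε∈L = [ (λ ε∈A₁ → ⊆⇒⊆ᶠ N⊆N* (∈ᶠ-∷⁻ (All.lookup A⊆β∷N (A₁⊆A ε∈A₁)) (A₁≉β ε∈A₁))) , M⊆N* ]′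
                 (∈-++⁻ A₁ ε∈L)
    M⊆L : concat M ⊆ᵈ concat L
    M⊆L = concat-lub (⊆-concat ∘ ∈-++⁺ʳ A₁)
    β⊆A : β ⊆ᵈ concat A
    β⊆A = ⊆-trans (proj₁ β≐β₀) (⊆-concat β₀∈A)
    member⊆L : ∀ {ε} → ε ∈ A → Dec (β ≐ ε) → ε ⊆ᵈ concat L
    member⊆L _   (yes β≐ε) = ⊆-trans (proj₂ β≐ε) (⊆-trans (proj₂ concat-M) M⊆L)
    member⊆L ε∈A (no β≉ε)  = ⊆-concat (∈-++⁺ˡ (∈-filter⁺ ≉β? ε∈A β≉ε))
    L≐A : concat L ≐ concat A
    L≐A = concat-lub (λ ε∈L → [ ⊆-concat ∘ A₁⊆A , (λ ε∈M → ⊆-trans (⊆β (M⇒MaxBelowβ ε∈M)) β⊆A) ]′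
                                (∈-++⁻ A₁ ε∈L)) ,
          concat-lub (λ {ε} ε∈A → member⊆L ε∈A (β ≐? ε))
    A⊈β : ¬ (concat A ⊆ᵈ β)
    A⊈β A⊆β = antichain-no-greatest A# len β₀∈A (⊆-trans A⊆β (proj₁ β≐β₀))
    from-antichain : ∃[ A° ] (IsAntichain N* A° × concat A° ≐ concat L) →
                     (concat A ∈C C) × ¬ (concat A ∈ᶠ (β ∷ B))
    from-antichain (A° , A°-ac , A°≐L) =
      ∈C-⊆ {C = C} (proj₂ A°≐A) (proj₁ (N*-outside A° A°-ac)) ,
      ∉ᶠ-∷ (A⊈β ∘ proj₂) (proj₂ (N*-outside A° A°-ac) ∘ ∈ᶠ-resp-≐ (≐-sym A°≐A))
      where
      A°≐A : concat A° ≐ concat A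
      A°≐A = ≐-trans A°≐L L≐A
    no-greatest : ¬ (∃[ s ] (s ∈ L × concat L ⊆ᵈ s))
    no-greatest (s , s∈L , L⊆s) with ∈-++⁻ A₁ s∈L
    ... | inj₁ s∈A₁ = proj₂ (A₁#β s∈A₁) (⊆-trans (proj₂ concat-M) (⊆-trans M⊆L L⊆s))
    ... | inj₂ s∈M  = A⊈β (⊆-trans (proj₂ L≐A) (⊆-trans L⊆s (⊆β (M⇒MaxBelowβ s∈M))))

  β∷N-outside : {N* N : Fam d} → All (_∈ᶠ B) N* → UnionsOutside C B N* → M ⊆ᶠ N* → N ⊆ N* →
                ¬ (M ⊆ᶠ N) → UnionsOutside C (β ∷ B) (β ∷ N)
  β∷N-outside {N*} {N} N*⊆B N*-outside M⊆N* N⊆N* M⊈N A (A⊆β∷N , len , A#) with any? (β ≐?_) A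
  ... | yes has-β = let β₀ , β₀∈A , β≐β₀ = find has-β in
                    union-via-β-outside N*-outside M⊆N* N⊆N* A⊆β∷N len A# β₀∈A β≐β₀
  ... | no no-β =
    proj₁ (N*-outside A A-ac*) ,
    ∉ᶠ-∷ (M⊈N ∘ union-β⇒M⊆ᶠ N N⊆B (UnionsOutside-⊆ {C = C} N⊆N* N*-outside) A A-ac ∘ ≐-sym)
         (proj₂ (N*-outside A A-ac*))
    where
    A-ac : IsAntichain N A
    A-ac = All.tabulate (λ ε∈A → ∈ᶠ-∷⁻ (All.lookup A⊆β∷N ε∈A) (no-β ∘ lose ε∈A)) , len , A#
    A-ac* : IsAntichain N* A
    A-ac* = IsAntichain-mono (⊆⇒⊆ᶠ N⊆N*) A-ac
    N⊆B : All (_∈ᶠ B) N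
    N⊆B = All.tabulate (All.lookup N*⊆B ∘ N⊆N*)

  Sb⇒Bl : {γ : FSet d} → Sb C (β ∷ B) γ → Bl α (Sb C B) γ
  Sb⇒Bl {γ} (N′ , (N′⊆βB , N′-outside) , γ≐N′) with β ∈ᶠ? N′
  ... | no β∉N′ = inj₁ ((N′ , (N′⊆B , UnionsOutside-∷⁻ {C = C} N′-outside) , γ≐N′) , α⊈γ)
    where
    N′⊆B : All (_∈ᶠ B) N′
    N′⊆B = All.tabulate (λ s∈N′ → ∈ᶠ-∷⁻ (All.lookup N′⊆βB s∈N′) (β∉N′ ∘ lose s∈N′ ∘ ≐-sym))
    α⊈γ : ¬ (α ⊆ᵈ γ)
    α⊈γ α⊆γ = β∉N′ (M⊆ᶠ⇒β∈ᶠ N′ (λ A A-ac → proj₂ (N′-outside A A-ac) ∘ here)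
                      (α⊆⇒M⊆ᶠ (βB.∈X⇒∈C ∘ All.lookup N′⊆βB) (⊆-trans α⊆γ (proj₁ γ≐N′))))
  ... | yes β∈N′ =
    inj₂ ([ N ]⁺ , α⊈[N]⁺ , (M ++ N , (M++N⊆B , M++N-outside N′-outside β∈N′ N⊆N′) , α++[N]⁺≐) , γ≐)
    where
    ≉β? : (s : FSet d) → Dec (¬ (β ≐ s))
    ≉β? s = ¬? (β ≐? s)
    N : Fam d
    N = filter ≉β? N′
    N⊆N′ : N ⊆ N′
    N⊆N′ = proj₁ ∘ ∈-filter⁻ ≉β? {xs = N′}
    N≉β : ∀ {s} → s ∈ N → ¬ (β ≐ s)
    N≉β = proj₂ ∘ ∈-filter⁻ ≉β? {xs = N′}
    N⊆B : All (_∈ᶠ B) N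
    N⊆B = All.tabulate (λ s∈N → ∈ᶠ-∷⁻ (All.lookup N′⊆βB (N⊆N′ s∈N)) (N≉β s∈N))
    α⊈[N]⁺ : ¬ (α ⊆ᵈ [ N ]⁺)
    α⊈[N]⁺ α⊆ with find (M⊆ᶠ⇒β∈ᶠ N (λ A A-ac → proj₂ (UnionsOutside-⊆ {C = C} N⊆N′ N′-outside A A-ac) ∘ here)
                                  (α⊆⇒M⊆ᶠ (B.∈X⇒∈C ∘ All.lookup N⊆B) α⊆))
    ... | s , s∈N , s≐β = N≉β s∈N (≐-sym s≐β)
    M++N⊆B : All (_∈ᶠ B) (M ++ N)
    M++N⊆B = All.++⁺ (All.tabulate (∈B ∘ M⇒MaxBelowβ)) N⊆B
    α++[N]⁺≐ : (α ++ [ N ]⁺) ≐ [ M ++ N ]⁺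
    α++[N]⁺≐ = ⊆-reflexive (sym (List.map-++ _⁺ M N)) , ⊆-reflexive (List.map-++ _⁺ M N)
    γ≐ : γ ≐ (α ⁺ ∷ [ N ]⁺)
    γ≐ = subst (λ v → γ ≐ (v ∷ [ N ]⁺)) β⁺≡α⁺ (≐-trans γ≐N′ ([]⁺-split β∈N′))

  Sb-unaffected : {γ : FSet d} → Sb C B γ → ¬ (α ⊆ᵈ γ) → Sb C (β ∷ B) γ
  Sb-unaffected (N , (N⊆B , N-outside) , γ≐N) α⊈γ = N , (All.map there N⊆B , N-outside′) , γ≐N
    where
    N-outside′ : UnionsOutside C (β ∷ B) N
    N-outside′ A A-ac =
      proj₁ (N-outside A A-ac) ,
      ∉ᶠ-∷ (λ β≐A → α⊈γ (⊆-trans (M⊆ᶠ⇒α⊆ (union-β⇒M⊆ᶠ N N⊆B N-outside A A-ac (≐-sym β≐A))) (proj₂ γ≐N)))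
           (proj₂ (N-outside A A-ac))

  Sb-blownUp : {γ δ : FSet d} → ¬ (α ⊆ᵈ δ) → Sb C B (α ++ δ) → γ ≐ (α ⁺ ∷ δ) → Sb C (β ∷ B) γ
  Sb-blownUp {γ} {δ} α⊈δ (N* , (N*⊆B , N*-outside) , α∪δ≐N*) γ≐ =
    β ∷ N , (here ≐-refl ∷ All.map there N⊆B , β∷N-outside N*⊆B N*-outside M⊆N* N⊆N* M⊈N) , γ≐′
    where
    ∈δ? : (ν : FSet d) → Dec (ν ⁺ ∈ δ)
    ∈δ? ν = ν ⁺ ∈? δ
    N : Fam d
    N = filter ∈δ? N*
    N⊆N* : N ⊆ N*
    N⊆N* = proj₁ ∘ ∈-filter⁻ ∈δ? {xs = N*}
    N⊆B : All (_∈ᶠ B) N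
    N⊆B = All.tabulate (All.lookup N*⊆B ∘ N⊆N*)
    M⊆N* : M ⊆ᶠ N*
    M⊆N* = α⊆⇒M⊆ᶠ (B.∈X⇒∈C ∘ All.lookup N*⊆B) (⊆-trans ∈-++⁺ˡ (proj₁ α∪δ≐N*))
    [N]⁺⊆δ : [ N ]⁺ ⊆ δ
    [N]⁺⊆δ v∈ with ∈-map⁻ _⁺ v∈
    ... | ν , ν∈N , refl = proj₂ (∈-filter⁻ ∈δ? {xs = N*} ν∈N)
    δ⊆[N]⁺ : δ ⊆ [ N ]⁺
    δ⊆[N]⁺ v∈δ with ∈-map⁻ _⁺ (proj₁ α∪δ≐N* (∈-++⁺ʳ α v∈δ))
    ... | ν , ν∈N* , refl = ∈-map⁺ _⁺ (∈-filter⁺ ∈δ? ν∈N* v∈δ)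
    M⊈N : ¬ (M ⊆ᶠ N)
    M⊈N M⊆N = α⊈δ (⊆-trans (M⊆ᶠ⇒α⊆ M⊆N) [N]⁺⊆δ)
    γ≐′ : γ ≐ [ β ∷ N ]⁺
    γ≐′ = subst (λ v → γ ≐ (v ∷ [ N ]⁺)) (sym β⁺≡α⁺) (≐-trans γ≐ (∷-≐ (δ⊆[N]⁺ , [N]⁺⊆δ)))

  Bl⇒Sb : {γ : FSet d} → Bl α (Sb C B) γ → Sb C (β ∷ B) γ
  Bl⇒Sb (inj₁ (γ∈Sb , α⊈γ))             = Sb-unaffected γ∈Sb α⊈γ
  Bl⇒Sb (inj₂ (_ , α⊈δ , α∪δ∈Sb , γ≐)) = Sb-blownUp α⊈δ α∪δ∈Sb γ≐

proposition8p1 : (d : ℕ) → 0 < d → (C : Complex d) → VerticesInTX C →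
    FaithfullyRealizes C → (B : Fam d) → (β : FSet d) →
    IsBuildingSet C B → IsBuildingSet C (β ∷ B) →
    ∀ (γ : FSet d) → Sb C (β ∷ B) γ ⇔ Bl ([ maxF (restrict B β) ]⁺) (Sb C B) γ
proposition8p1 d _ C _ faithful B β building building-β γ = mk⇔ Sb⇒Bl Bl⇒Sb
  where open Blowup C faithful B β building building-β
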